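{- Let $p$ be an odd prime and let $k$ be a non-negative integer. If $(x,y)$ is a solution in positive integers of the equation \[ x^2-(p^{2k+2}+1)y^2=-p^{2k+1} \] and $y\geq p^{\frac{2k+1}{2}}$, then \[ \sqrt{p^{2k+2}+1}+\frac{x}{y}>2p^{k+1}. \] -}

module Defs where

open import Data.Nat using (ℕ)
import Data.Nat as N
open import Data.Integer using (ℤ; +_; _*_; _<_)
open import Data.Sum using (_⊎_)

-- "√D > a / b" for D : ℕ, integers a, b with b > 0 (√D the non-negative
-- real square root): holds iff a < 0, or a² < D·b².
-- (If a < 0 then a/b < 0 ≤ √D; if a ≥ 0 then both sides are ≥ 0 and we square.)
SqrtGtFrac : ℕ → ℤ → ℤ → Set
SqrtGtFrac D a b = (a < + 0) ⊎ (a * a < (+ D) * (b * b))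

-- "y ≥ √N" for y N : ℕ  ⇔  N ≤ y²  (both sides non-negative).
GeSqrt : ℕ → ℕ → Set
GeSqrt y N = N N.≤ y N.* y

-- Write q = p^(k+1) and n = p^(2k+1), so the equation reads x² + n = (q² + 1) y².
-- The hypothesis n ≤ y² forces x² ≥ q² y², i.e. x ≥ q y.  Reflecting x about q y
-- cannot increase its absolute value: |2qy − x| ≤ x, hence
-- (2qy − x)² ≤ x² < x² + n = (q² + 1) y², which is √D > (2qy − x)/y.
module Submission where

open import Defs
open import Data.Nat using (ℕ; suc; _+_; _*_; _^_; _<_; _%_; _≤_; _∸_; _≤?_)
open import Data.Nat.Properties
  using (≮⇒≥; <⇒≱; ≰⇒>; *-mono-<; *-mono-≤; *-monoʳ-≤; +-monoʳ-≤; +-cancelʳ-≤;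
         ∸-monoˡ-≤; m+n∸m≡n; +-identityʳ; m<m+n; m<n⇒0<n∸m; *-assoc; m^n>0;
         ^-distribˡ-+-*; module ≤-Reasoning)
open import Data.Nat.Primality using (Prime; prime⇒nonZero)
open import Data.Integer using (ℤ; +_; -_; +<+) renaming (_*_ to _*ℤ_; _-_ to _-ℤ_; _+_ to _+ℤ_; _<_ to _<ℤ_)
open import Data.Integer.Properties using (pos-+; pos-*; +-injective; m-n≡m⊖n; ⊖-≥; ⊖-≰; neg-mono-<)
import Data.Integer.Tactic.RingSolver as ℤ-Solver
import Data.Nat.Tactic.RingSolver as ℕ-Solver
open import Data.List using ([]; _∷_)
open import Data.Sum using (inj₁; inj₂)
open import Relation.Nullary using (yes; no)
open import Relation.Binary.PropositionalEquality
  using (_≡_; sym; trans; cong; subst; subst₂; module ≡-Reasoning)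

i-j≡-k⇒i+k≡j : ∀ (i j k : ℤ) → i -ℤ j ≡ - k → i +ℤ k ≡ j
i-j≡-k⇒i+k≡j i j k i-j≡-k = begin
  i +ℤ k                         ≡⟨ ℤ-Solver.solve (i ∷ j ∷ k ∷ []) ⟩
  (i -ℤ j) -ℤ (- k) +ℤ j         ≡⟨ cong (λ t → t -ℤ (- k) +ℤ j) i-j≡-k ⟩
  (- k) -ℤ (- k) +ℤ j            ≡⟨ ℤ-Solver.solve (k ∷ j ∷ []) ⟩
  j                              ∎
  where open ≡-Reasoning

x²-Dy²≡-n⇒x²+n≡Dy² : ∀ D n x y → (+ x) *ℤ (+ x) -ℤ (+ D) *ℤ ((+ y) *ℤ (+ y)) ≡ - (+ n) →
                      x * x + n ≡ D * (y * y)
x²-Dy²≡-n⇒x²+n≡Dy² D n x y pell = +-injective (begin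
  + (x * x + n)                  ≡⟨ pos-+ (x * x) n ⟩
  + (x * x) +ℤ + n               ≡⟨ cong (_+ℤ + n) (pos-* x x) ⟩
  (+ x) *ℤ (+ x) +ℤ + n          ≡⟨ i-j≡-k⇒i+k≡j ((+ x) *ℤ (+ x)) _ _ pell ⟩
  (+ D) *ℤ ((+ y) *ℤ (+ y))      ≡⟨ cong ((+ D) *ℤ_) (sym (pos-* y y)) ⟩
  (+ D) *ℤ + (y * y)             ≡⟨ sym (pos-* D (y * y)) ⟩
  + (D * (y * y))                ∎)
  where open ≡-Reasoning

m^[2k+2]≡m^[k+1]² : ∀ m k → m ^ (2 * k + 2) ≡ m ^ suc k * m ^ suc k
m^[2k+2]≡m^[k+1]² m k = trans (cong (m ^_) 2k+2≡[k+1]+[k+1]) (^-distribˡ-+-* m (suc k) (suc k))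
  where
  2k+2≡[k+1]+[k+1] : 2 * k + 2 ≡ suc k + suc k
  2k+2≡[k+1]+[k+1] = ℕ-Solver.solve (k ∷ [])

m*m≤n*n⇒m≤n : ∀ {m n} → m * m ≤ n * n → m ≤ n
m*m≤n*n⇒m≤n m²≤n² = ≮⇒≥ (λ n<m → <⇒≱ (*-mono-< n<m n<m) m²≤n²)

m≤n⇒2m∸n≤n : ∀ {m n} → m ≤ n → 2 * m ∸ n ≤ n
m≤n⇒2m∸n≤n {m} {n} m≤n = begin
  2 * m ∸ n          ≤⟨ ∸-monoˡ-≤ n (*-monoʳ-≤ 2 m≤n) ⟩
  n + (n + 0) ∸ n    ≡⟨ m+n∸m≡n n (n + 0) ⟩
  n + 0              ≡⟨ +-identityʳ n ⟩
  n                  ∎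
  where open ≤-Reasoning

x²+n≡[q²+1]y²⇒qy≤x : ∀ q n x y → x * x + n ≡ (q * q + 1) * (y * y) → n ≤ y * y → q * y ≤ x
x²+n≡[q²+1]y²⇒qy≤x q n x y pell n≤y² = m*m≤n*n⇒m≤n (+-cancelʳ-≤ n _ _ (begin
  q * y * (q * y) + n        ≤⟨ +-monoʳ-≤ (q * y * (q * y)) n≤y² ⟩
  q * y * (q * y) + y * y    ≡⟨ ℕ-Solver.solve (q ∷ y ∷ []) ⟩
  (q * q + 1) * (y * y)      ≡⟨ sym pell ⟩
  x * x + n                  ∎))
  where open ≤-Reasoning

√D>[2m-x]/y : ∀ D n m x y → x * x + n ≡ D * (y * y) → 0 < n → m ≤ x →
              SqrtGtFrac D (+ (2 * m) -ℤ + x) (+ y)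
√D>[2m-x]/y D n m x y pell n>0 m≤x rewrite m-n≡m⊖n (2 * m) x with x ≤? 2 * m
... | no  x≰2m rewrite ⊖-≰ x≰2m = inj₁ (neg-mono-< (+<+ (m<n⇒0<n∸m (≰⇒> x≰2m))))
... | yes x≤2m rewrite ⊖-≥ x≤2m =
  inj₂ (subst₂ _<ℤ_ (pos-* t t) (trans (pos-* D (y * y)) (cong ((+ D) *ℤ_) (pos-* y y)))
    (+<+ (begin-strict
      t * t          ≤⟨ *-mono-≤ t≤x t≤x ⟩
      x * x          <⟨ m<m+n (x * x) n>0 ⟩
      x * x + n      ≡⟨ pell ⟩
      D * (y * y)    ∎)))
  where
  open ≤-Reasoning
  t = 2 * m ∸ x
  t≤x : t ≤ x
  t≤x = m≤n⇒2m∸n≤n m≤x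

lemma3 : (p k x y : ℕ) → Prime p → p % 2 ≡ 1 → 0 < x → 0 < y →
    (+ x) *ℤ (+ x) -ℤ (+ (p ^ (2 * k + 2) + 1)) *ℤ ((+ y) *ℤ (+ y)) ≡ - (+ (p ^ (2 * k + 1))) →
    GeSqrt y (p ^ (2 * k + 1)) →
    SqrtGtFrac (p ^ (2 * k + 2) + 1) ((+ (2 * p ^ (suc k))) *ℤ (+ y) -ℤ (+ x)) (+ y)
lemma3 p k x y p-prime _ _ _ pell n≤y² =
  subst (λ a → SqrtGtFrac D a (+ y)) 2qy-x≡2q*y-x
    (√D>[2m-x]/y D n (q * y) x y x²+n≡Dy² (m^n>0 p (2 * k + 1)) qy≤x)
  where
  instance _ = prime⇒nonZero p-prime
  q = p ^ suc k
  n = p ^ (2 * k + 1)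
  D = p ^ (2 * k + 2) + 1
  x²+n≡Dy² : x * x + n ≡ D * (y * y)
  x²+n≡Dy² = x²-Dy²≡-n⇒x²+n≡Dy² D n x y pell
  qy≤x : q * y ≤ x
  qy≤x = x²+n≡[q²+1]y²⇒qy≤x q n x y
    (trans x²+n≡Dy² (cong (λ s → (s + 1) * (y * y)) (m^[2k+2]≡m^[k+1]² p k))) n≤y²
  2qy-x≡2q*y-x : + (2 * (q * y)) -ℤ + x ≡ (+ (2 * q)) *ℤ (+ y) -ℤ + x
  2qy-x≡2q*y-x = cong (_-ℤ + x) (trans (cong +_ (sym (*-assoc 2 q y))) (pos-* (2 * q) y))
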